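{- Let $k\ge3$ be an integer and $\mathfrak F^+=\mathbf D(C_k\oplus C_7,\{(0,0),(0,1),(0,3),(1,0)\})$. (i) If $7\nmid k$, then $\mathrm{Aut}(\mathfrak F^+)\cong C_k\oplus C_7$. (ii) If $7\mid k$, then $\mathrm{Aut}(\mathfrak F^+)\cong C_3\ltimes(C_k\oplus C_7)$.
   Context: $C_m=\mathbb Z/m\mathbb Z$. For an abelian group $\mathsf G$ and $D\subseteq G$, $\mathbf D(\mathsf G,D)$ is the incidence structure whose points are the elements of $G$ and whose lines are the translates $b+D$, $b\in G$, incidence being membership; $\mathrm{Aut}$ denotes its group of automorphisms (pairs of bijections of points and lines preserving and reflecting incidence). Translations $x\mapsto x+v$ are automorphisms; in (ii) the subgroup $C_3$ arises from the maps multiplying the $C_7$-coordinate by $2$ and by $4$. -}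

module Defs where

open import Data.Nat using (ℕ; zero; suc; _+_; _*_; _^_; _≤_; NonZero)
open import Data.Nat.DivMod using (_%_; m%n<n)
open import Data.Fin using (Fin; toℕ; fromℕ<)
open import Data.Product using (Σ; _×_; _,_; proj₁; proj₂)
open import Data.Sum using (_⊎_)
open import Function.Bundles using (_⇔_)
open import Relation.Binary.PropositionalEquality using (_≡_)

ofℕ : (n : ℕ) .{{_ : NonZero n}} → ℕ → Fin n
ofℕ n m = fromℕ< (m%n<n m n)

addC : (n : ℕ) .{{_ : NonZero n}} → Fin n → Fin n → Fin n
addC n a b = ofℕ n (toℕ a + toℕ b)

mulC : (n : ℕ) .{{_ : NonZero n}} → Fin n → Fin n → Fin n
mulC n a b = ofℕ n (toℕ a * toℕ b)

module _ (k : ℕ) .{{_ : NonZero k}} where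

  G : Set
  G = Fin k × Fin 7

  _⊕_ : G → G → G
  (a , b) ⊕ (c , d) = addC k a c , addC 7 b d

  el : ℕ → ℕ → G
  el m n = ofℕ k m , ofℕ 7 n

  InD : G → Set
  InD g = (g ≡ el 0 0) ⊎ (g ≡ el 0 1) ⊎ (g ≡ el 0 3) ⊎ (g ≡ el 1 0)

  -- Lines are the translates b + D;
  -- a line is named by a translation vector b ∈ G, two names denoting the
  -- same line iff the translates are equal as sets (relation _~_ below).
  Point : Set
  Point = G

  LineName : Set
  LineName = G

  Inc : Point → LineName → Set
  Inc x b = Σ G λ d → InD d × (x ≡ b ⊕ d)

  _~_ : LineName → LineName → Set
  b ~ c = ∀ x → Inc x b ⇔ Inc x c

  -- An automorphism: a bijection α of points and a bijection β of lines
  -- (β acting on line names, well defined on lines, with an inverse up to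
  -- equality of lines), preserving and reflecting incidence.
  record Aut : Set where
    field
      α      : Point → Point
      α⁻     : Point → Point
      α⁻α    : ∀ x → α⁻ (α x) ≡ x
      αα⁻    : ∀ x → α (α⁻ x) ≡ x
      β      : LineName → LineName
      β⁻     : LineName → LineName
      β-resp  : ∀ b c → b ~ c → β b ~ β c
      β⁻-resp : ∀ b c → b ~ c → β⁻ b ~ β⁻ c
      β⁻β    : ∀ b → β⁻ (β b) ~ b
      ββ⁻    : ∀ b → β (β⁻ b) ~ b
      incid  : ∀ x b → Inc x b ⇔ Inc (α x) (β b)

  open Aut public

  _≈A_ : Aut → Aut → Set
  f ≈A g = (∀ x → α f x ≡ α g x) × (∀ b → β f b ~ β g b)

  -- composition (the group operation of Aut): first g, then f
  module _ where
    open import Function.Bundles using (mk⇔; Equivalence)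
    open Equivalence

    _∘A_ : Aut → Aut → Aut
    f ∘A g = record
      { α = λ x → α f (α g x)
      ; α⁻ = λ x → α⁻ g (α⁻ f x)
      ; α⁻α = λ x → trans' (cong' (α⁻ g) (α⁻α f (α g x))) (α⁻α g x)
      ; αα⁻ = λ x → trans' (cong' (α f) (αα⁻ g (α⁻ f x))) (αα⁻ f x)
      ; β = λ b → β f (β g b)
      ; β⁻ = λ b → β⁻ g (β⁻ f b)
      ; β-resp = λ b c e → β-resp f (β g b) (β g c) (β-resp g b c e)
      ; β⁻-resp = λ b c e → β⁻-resp g (β⁻ f b) (β⁻ f c) (β⁻-resp f b c e)
      ; β⁻β = λ b → ~trans (β⁻ g (β⁻ f (β f (β g b)))) (β⁻ g (β g b)) b (β⁻-resp g (β⁻ f (β f (β g b))) (β g b) (β⁻β f (β g b))) (β⁻β g b)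
      ; ββ⁻ = λ b → ~trans (β f (β g (β⁻ g (β⁻ f b)))) (β f (β⁻ f b)) b (β-resp f (β g (β⁻ g (β⁻ f b))) (β⁻ f b) (ββ⁻ g (β⁻ f b))) (ββ⁻ f b)
      ; incid = λ x b → ⇔trans (incid g x b) (incid f (α g x) (β g b))
      }
      where
        open import Relation.Binary.PropositionalEquality using () renaming (trans to trans'; cong to cong')
        ⇔trans : ∀ {A B C : Set} → A ⇔ B → B ⇔ C → A ⇔ C
        ⇔trans p q = mk⇔ (λ a → to q (to p a)) (λ c → from p (from q c))
        ~trans : ∀ a b c → a ~ b → b ~ c → a ~ c
        ~trans _ _ _ p q x = ⇔trans (p x) (q x)

  AutIso : (H : Set) → (H → H → H) → Set
  AutIso H _·_ =
    Σ (Aut → H) λ φ →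
      (∀ f g → f ≈A g → φ f ≡ φ g) ×
      (∀ f g → φ (f ∘A g) ≡ φ f · φ g) ×
      (∀ f g → φ f ≡ φ g → f ≈A g) ×
      (∀ h → Σ Aut λ f → φ f ≡ h)

  -- the semidirect product C_3 ⋉ (C_k ⊕ C_7), the generator of C_3 acting by
  -- multiplying the C_7-coordinate by 2:
  -- (i, a, b) · (j, c, d) = (i + j, a + c, b + 2^i d)
  SD : Set
  SD = Fin 3 × G

  _·SD_ : SD → SD → SD
  (i , (a , b)) ·SD (j , (c , d)) =
    addC 3 i j , (addC k a c , addC 7 b (mulC 7 (ofℕ 7 (2 ^ toℕ i)) d))

module Submission where

-- Write points as (a, y) ∈ C_k × C_7.  The line b = (a, c) consists of the
-- block {a} × (c + {0,1,3}), a line of the Fano plane on the fibre over a,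
-- together with its tip (a+1, c).
--
-- Every automorphism is affine (Classification).  Two distinct points of a
-- fibre lie in a 5-clique of the collinearity graph, two collinear points of
-- adjacent fibres do not, so automorphisms preserve fibres (FibrePreservation)
-- and act as α (a, y) = (σ a, g_a y).  Tips go to tips, so σ is a translation
-- and g_a maps blocks into blocks of g_{a+1}; rigidity of the Fano plane (Fano)
-- makes g_a affine, y ↦ 2^i y + t_a with t_{a+1} = t_a + (1 - 2^i).  Going once
-- around C_k forces i = 0 or 7 ∣ k.
--
-- Conversely every admissible parameter triple (i, s, t) is an automorphism
-- (AffineFamily), and the parameters compose like C_k ⊕ C_7 when 7 ∤ k and like
-- C_3 ⋉ (C_k ⊕ C_7) when 7 ∣ k (Isomorphism, Cases).

open import Defs
open import Data.Nat using (ℕ; _≤_; NonZero)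
open import Data.Nat.Divisibility using (_∣_)
open import Data.Product using (_×_; _,_)
open import Relation.Nullary using (¬_)

module ModArith where

  open import Data.Nat using (ℕ; suc; _+_; _∸_; _<_; NonZero; >-nonZero⁻¹)
  open import Data.Nat.Properties using (+-comm; +-assoc; m+[n∸m]≡n; <⇒≤)
  open import Data.Nat.DivMod using (_%_; m%n<n; %-distribˡ-+; m<n⇒m%n≡m; n%n≡0; m∣n⇒o%n%m≡o%m)
  open import Data.Nat.Divisibility using (_∣_)
  open import Data.Fin using (Fin; toℕ)
  open import Data.Fin.Properties using (toℕ-fromℕ<; toℕ-injective; toℕ<n)
  open import Relation.Binary.PropositionalEquality using (_≡_; sym; trans; cong; cong₂; module ≡-Reasoning)
  open ≡-Reasoning

  module _ (n : ℕ) .{{_ : NonZero n}} where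

    toℕ-ofℕ : ∀ m → toℕ (ofℕ n m) ≡ m % n
    toℕ-ofℕ m = toℕ-fromℕ< (m%n<n m n)

    ofℕ-cong : ∀ {m m'} → m % n ≡ m' % n → ofℕ n m ≡ ofℕ n m'
    ofℕ-cong {m} {m'} e = toℕ-injective (trans (toℕ-ofℕ m) (trans e (sym (toℕ-ofℕ m'))))

    ofℕ-injective : ∀ {m m'} → m < n → m' < n → ofℕ n m ≡ ofℕ n m' → m ≡ m'
    ofℕ-injective {m} {m'} m<n m'<n e = begin
        m                 ≡⟨ sym (m<n⇒m%n≡m m<n) ⟩
        m % n             ≡⟨ sym (toℕ-ofℕ m) ⟩
        toℕ (ofℕ n m)     ≡⟨ cong toℕ e ⟩
        toℕ (ofℕ n m')    ≡⟨ toℕ-ofℕ m' ⟩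
        m' % n            ≡⟨ m<n⇒m%n≡m m'<n ⟩
        m'                ∎

    ofℕ-toℕ : ∀ (a : Fin n) → ofℕ n (toℕ a) ≡ a
    ofℕ-toℕ a = toℕ-injective (trans (toℕ-ofℕ (toℕ a)) (m<n⇒m%n≡m (toℕ<n a)))

    add-ofℕ : ∀ m m' → addC n (ofℕ n m) (ofℕ n m') ≡ ofℕ n (m + m')
    add-ofℕ m m' = ofℕ-cong (trans (cong₂ (λ u v → (u + v) % n) (toℕ-ofℕ m) (toℕ-ofℕ m'))
                                    (sym (%-distribˡ-+ m m' n)))

    0̂ : Fin n
    0̂ = ofℕ n 0

    1̂ : Fin n
    1̂ = ofℕ n 1

    ofℕ-self : ofℕ n n ≡ 0̂
    ofℕ-self = ofℕ-cong (trans (n%n≡0 n) (sym (m<n⇒m%n≡m (>-nonZero⁻¹ n))))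

    add-comm : ∀ (a b : Fin n) → addC n a b ≡ addC n b a
    add-comm a b = cong (ofℕ n) (+-comm (toℕ a) (toℕ b))

    add-assoc : ∀ (a b c : Fin n) → addC n (addC n a b) c ≡ addC n a (addC n b c)
    add-assoc a b c = begin
        addC n (addC n a b) c
      ≡⟨ cong (addC n (addC n a b)) (sym (ofℕ-toℕ c)) ⟩
        addC n (ofℕ n (toℕ a + toℕ b)) (ofℕ n (toℕ c))
      ≡⟨ add-ofℕ (toℕ a + toℕ b) (toℕ c) ⟩
        ofℕ n (toℕ a + toℕ b + toℕ c)
      ≡⟨ cong (ofℕ n) (+-assoc (toℕ a) (toℕ b) (toℕ c)) ⟩
        ofℕ n (toℕ a + (toℕ b + toℕ c))
      ≡⟨ sym (add-ofℕ (toℕ a) (toℕ b + toℕ c)) ⟩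
        addC n (ofℕ n (toℕ a)) (ofℕ n (toℕ b + toℕ c))
      ≡⟨ cong (λ u → addC n u (addC n b c)) (ofℕ-toℕ a) ⟩
        addC n a (addC n b c)
      ∎

    add-zeroʳ : ∀ (a : Fin n) → addC n a 0̂ ≡ a
    add-zeroʳ a = begin
        addC n a 0̂
      ≡⟨ cong (λ u → addC n u 0̂) (sym (ofℕ-toℕ a)) ⟩
        addC n (ofℕ n (toℕ a)) 0̂
      ≡⟨ add-ofℕ (toℕ a) 0 ⟩
        ofℕ n (toℕ a + 0)
      ≡⟨ cong (ofℕ n) (+-comm (toℕ a) 0) ⟩
        ofℕ n (toℕ a)
      ≡⟨ ofℕ-toℕ a ⟩
        a
      ∎

    add-zeroˡ : ∀ (a : Fin n) → addC n 0̂ a ≡ a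
    add-zeroˡ a = trans (add-comm 0̂ a) (add-zeroʳ a)

    neg : Fin n → Fin n
    neg a = ofℕ n (n ∸ toℕ a)

    add-negʳ : ∀ (a : Fin n) → addC n a (neg a) ≡ 0̂
    add-negʳ a = begin
        addC n a (neg a)
      ≡⟨ cong (λ u → addC n u (neg a)) (sym (ofℕ-toℕ a)) ⟩
        addC n (ofℕ n (toℕ a)) (neg a)
      ≡⟨ add-ofℕ (toℕ a) (n ∸ toℕ a) ⟩
        ofℕ n (toℕ a + (n ∸ toℕ a))
      ≡⟨ cong (ofℕ n) (m+[n∸m]≡n (<⇒≤ (toℕ<n a))) ⟩
        ofℕ n n
      ≡⟨ ofℕ-self ⟩
        0̂
      ∎

    add-negˡ : ∀ (a : Fin n) → addC n (neg a) a ≡ 0̂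
    add-negˡ a = trans (add-comm (neg a) a) (add-negʳ a)

    add-cancelˡ : ∀ (a x y : Fin n) → addC n a x ≡ addC n a y → x ≡ y
    add-cancelˡ a x y e = begin
        x
      ≡⟨ sym (add-zeroˡ x) ⟩
        addC n 0̂ x
      ≡⟨ cong (λ u → addC n u x) (sym (add-negˡ a)) ⟩
        addC n (addC n (neg a) a) x
      ≡⟨ add-assoc (neg a) a x ⟩
        addC n (neg a) (addC n a x)
      ≡⟨ cong (addC n (neg a)) e ⟩
        addC n (neg a) (addC n a y)
      ≡⟨ sym (add-assoc (neg a) a y) ⟩
        addC n (addC n (neg a) a) y
      ≡⟨ cong (λ u → addC n u y) (add-negˡ a) ⟩
        addC n 0̂ y
      ≡⟨ add-zeroˡ y ⟩
        y
      ∎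

    add-cancelʳ : ∀ (a x y : Fin n) → addC n x a ≡ addC n y a → x ≡ y
    add-cancelʳ a x y e = add-cancelˡ a x y (trans (add-comm a x) (trans e (add-comm y a)))

    add-stable⇒zero : ∀ (a x : Fin n) → addC n a x ≡ a → x ≡ 0̂
    add-stable⇒zero a x e = add-cancelˡ a x 0̂ (trans e (sym (add-zeroʳ a)))

    sub : Fin n → Fin n → Fin n
    sub a b = addC n a (neg b)

    sub-add : ∀ (u p : Fin n) → sub (addC n u p) p ≡ u
    sub-add u p = begin
        addC n (addC n u p) (neg p)
      ≡⟨ add-assoc u p (neg p) ⟩
        addC n u (addC n p (neg p))
      ≡⟨ cong (addC n u) (add-negʳ p) ⟩
        addC n u 0̂
      ≡⟨ add-zeroʳ u ⟩
        u
      ∎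

    sub-injective : ∀ (t t' p : Fin n) → sub t p ≡ sub t' p → t ≡ t'
    sub-injective t t' p = add-cancelʳ (neg p) t t'

    ofℕ-suc : ∀ m → addC n (ofℕ n m) 1̂ ≡ ofℕ n (suc m)
    ofℕ-suc m = trans (add-ofℕ m 1) (cong (ofℕ n) (+-comm m 1))

  module _ (n m : ℕ) .{{_ : NonZero n}} .{{_ : NonZero m}} where

    reduce : Fin n → Fin m
    reduce a = ofℕ m (toℕ a)

    reduce-add : m ∣ n → ∀ a b → reduce (addC n a b) ≡ addC m (reduce a) (reduce b)
    reduce-add m∣n a b = trans
      (ofℕ-cong m (trans (cong (_% m) (toℕ-ofℕ n (toℕ a + toℕ b))) (m∣n⇒o%n%m≡o%m m n (toℕ a + toℕ b) m∣n)))
      (sym (add-ofℕ m (toℕ a) (toℕ b)))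

module C7Facts where

  -- The geometry of the difference set {0,1,3} in C_7 (the Fano plane).
  -- Every statement here quantifies over finitely many elements of C_3 and
  -- C_7 and is established by evaluating a decision procedure; the facts are
  -- opaque, so later proofs depend on their statements only.

  open ModArith using (neg; sub)
  open import Data.Nat using (_^_)
  open import Data.Fin using (Fin; zero; suc; toℕ; #_)
  open import Data.Fin.Properties using (_≟_; all?; any?)
  open import Data.Vec using (Vec; []; _∷_; lookup)
  open import Data.Unit using (tt)
  open import Data.Product using (∃; _×_)
  open import Data.Sum using (_⊎_)
  open import Relation.Nullary using (Dec)
  open import Relation.Nullary.Decidable using (toWitness; ¬?; _×-dec_; _⊎-dec_; _→-dec_)
  open import Relation.Binary.PropositionalEquality using (_≡_; _≢_)

  Z7 : Set
  Z7 = Fin 7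

  infixl 6 _+7_
  infixl 7 _*7_
  _+7_ : Z7 → Z7 → Z7
  a +7 b = addC 7 a b

  _*7_ : Z7 → Z7 → Z7
  a *7 b = mulC 7 a b

  _≢?_ : (u v : Z7) → Dec (u ≢ v)
  u ≢? v = ¬? (u ≟ v)

  offset : Fin 3 → Z7
  offset zero = # 0
  offset (suc zero) = # 1
  offset (suc (suc zero)) = # 3

  InBlock : Z7 → Z7 → Set
  InBlock y c = ∃ λ (j : Fin 3) → y ≡ c +7 offset j

  inBlock? : ∀ y c → Dec (InBlock y c)
  inBlock? y c = any? (λ j → y ≟ (c +7 offset j))

  PreservesBlocks : (Z7 → Z7) → (Z7 → Z7) → Set
  PreservesBlocks f g = ∀ y c → InBlock y c → InBlock (f y) (g c)

  opaque
    commonBlock : ∀ u v → ∃ λ c → InBlock u c × InBlock v c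
    commonBlock = toWitness {a? = all? λ u → all? λ v → any? λ c → inBlock? u c ×-dec inBlock? v c} tt

  opaque
    offsets-distinct : ∀ c → c +7 offset zero ≢ c +7 offset (suc zero)
    offsets-distinct = toWitness {a? = all? λ c → (c +7 offset zero) ≢? (c +7 offset (suc zero))} tt

  -- Two distinct points u v determine the third point of their block
  -- (thirdOnBlock) and the third base of the blocks through a common point
  -- (thirdOnCoblock); both are tabulated.
  thirdOnBlockTable : Vec (Vec Z7 7) 7
  thirdOnBlockTable = (# 0 ∷ # 3 ∷ # 6 ∷ # 1 ∷ # 5 ∷ # 4 ∷ # 2 ∷ [])
    ∷ (# 3 ∷ # 0 ∷ # 4 ∷ # 0 ∷ # 2 ∷ # 6 ∷ # 5 ∷ [])
    ∷ (# 6 ∷ # 4 ∷ # 0 ∷ # 5 ∷ # 1 ∷ # 3 ∷ # 0 ∷ [])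
    ∷ (# 1 ∷ # 0 ∷ # 5 ∷ # 0 ∷ # 6 ∷ # 2 ∷ # 4 ∷ [])
    ∷ (# 5 ∷ # 2 ∷ # 1 ∷ # 6 ∷ # 0 ∷ # 0 ∷ # 3 ∷ [])
    ∷ (# 4 ∷ # 6 ∷ # 3 ∷ # 2 ∷ # 0 ∷ # 0 ∷ # 1 ∷ [])
    ∷ (# 2 ∷ # 5 ∷ # 0 ∷ # 4 ∷ # 3 ∷ # 1 ∷ # 0 ∷ [])
    ∷ []

  thirdOnBlock : Z7 → Z7 → Z7
  thirdOnBlock u v = lookup (lookup thirdOnBlockTable u) v

  thirdOnCoblockTable : Vec (Vec Z7 7) 7
  thirdOnCoblockTable = (# 0 ∷ # 5 ∷ # 3 ∷ # 2 ∷ # 6 ∷ # 1 ∷ # 4 ∷ [])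
    ∷ (# 5 ∷ # 0 ∷ # 6 ∷ # 4 ∷ # 3 ∷ # 0 ∷ # 2 ∷ [])
    ∷ (# 3 ∷ # 6 ∷ # 0 ∷ # 0 ∷ # 5 ∷ # 4 ∷ # 1 ∷ [])
    ∷ (# 2 ∷ # 4 ∷ # 0 ∷ # 0 ∷ # 1 ∷ # 6 ∷ # 5 ∷ [])
    ∷ (# 6 ∷ # 3 ∷ # 5 ∷ # 1 ∷ # 0 ∷ # 2 ∷ # 0 ∷ [])
    ∷ (# 1 ∷ # 0 ∷ # 4 ∷ # 6 ∷ # 2 ∷ # 0 ∷ # 3 ∷ [])
    ∷ (# 4 ∷ # 2 ∷ # 1 ∷ # 5 ∷ # 0 ∷ # 3 ∷ # 0 ∷ [])
    ∷ []

  thirdOnCoblock : Z7 → Z7 → Z7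
  thirdOnCoblock u v = lookup (lookup thirdOnCoblockTable u) v

  opaque
    thirdOnBlock-unique : ∀ c u → InBlock u c → ∀ v → InBlock v c → ∀ w → InBlock w c →
      u ≢ v → u ≢ w → v ≢ w → w ≡ thirdOnBlock u v
    thirdOnBlock-unique = toWitness {a? = all? λ c → all? λ u → inBlock? u c →-dec
      all? λ v → inBlock? v c →-dec all? λ w → inBlock? w c →-dec
      (u ≢? v) →-dec (u ≢? w) →-dec (v ≢? w) →-dec (w ≟ thirdOnBlock u v)} tt

  opaque
    thirdOnCoblock-unique : ∀ y u → InBlock y u → ∀ v → InBlock y v → ∀ w → InBlock y w →
      u ≢ v → u ≢ w → v ≢ w → w ≡ thirdOnCoblock u v
    thirdOnCoblock-unique = toWitness {a? = all? λ y → all? λ u → inBlock? y u →-dec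
      all? λ v → inBlock? y v →-dec all? λ w → inBlock? y w →-dec
      (u ≢? v) →-dec (u ≢? w) →-dec (v ≢? w) →-dec (w ≟ thirdOnCoblock u v)} tt

  -- The affine maps y ↦ 2^i y + t.  Multiplication by 2^i maps {0,1,3} to
  -- drift i + {0,1,3}, where drift i = 1 - 2^i.
  pow2 : Fin 3 → Z7
  pow2 i = ofℕ 7 (2 ^ toℕ i)

  drift : Fin 3 → Z7
  drift zero = # 0
  drift (suc zero) = # 6
  drift (suc (suc zero)) = # 4

  affine : Fin 3 → Z7 → Z7 → Z7
  affine i t y = pow2 i *7 y +7 t

  shift : Fin 3 → Z7 → Z7 → Z7
  shift i t m = t +7 drift i *7 m

  -- A block-preserving g is determined by g 0 and g 1: these are its values.
  fanoSpan : Z7 → Z7 → Z7 → Z7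
  fanoSpan g0 g1 zero = g0
  fanoSpan g0 g1 (suc zero) = g1
  fanoSpan g0 g1 (suc (suc zero)) = thirdOnCoblock g0 (thirdOnBlock g0 g1)
  fanoSpan g0 g1 (suc (suc (suc zero))) = thirdOnBlock g0 g1
  fanoSpan g0 g1 (suc (suc (suc (suc zero)))) = thirdOnBlock g0 (thirdOnCoblock g0 g1)
  fanoSpan g0 g1 (suc (suc (suc (suc (suc zero))))) = thirdOnCoblock g0 g1
  fanoSpan g0 g1 (suc (suc (suc (suc (suc (suc zero)))))) =
    thirdOnBlock g0 (thirdOnCoblock g0 (thirdOnBlock g0 g1))

  -- When the two ways of computing the value at 4 agree, the span is affine.
  opaque
    fanoSpan-affine : ∀ g0 g1 → g0 ≢ g1 →
      thirdOnBlock g0 (thirdOnCoblock g0 g1) ≡ thirdOnBlock g1 (thirdOnCoblock g0 (thirdOnBlock g0 g1)) →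
      ∃ λ i → ∀ y → fanoSpan g0 g1 y ≡ affine i g0 y
    fanoSpan-affine = toWitness {a? = all? λ g0 → all? λ g1 → (g0 ≢? g1) →-dec
      (thirdOnBlock g0 (thirdOnCoblock g0 g1) ≟ thirdOnBlock g1 (thirdOnCoblock g0 (thirdOnBlock g0 g1))) →-dec
      any? λ i → all? λ y → fanoSpan g0 g1 y ≟ affine i g0 y} tt

  opaque
    affine-consecutive : ∀ i t i' t' → PreservesBlocks (affine i t) (affine i' t') →
      i ≡ i' × t' ≡ t +7 drift i
    affine-consecutive = toWitness {a? = all? λ i → all? λ t → all? λ i' → all? λ t' →
      (all? λ y → all? λ c → inBlock? y c →-dec inBlock? (affine i t y) (affine i' t' c)) →-dec
      ((i ≟ i') ×-dec (t' ≟ (t +7 drift i)))} tt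

  opaque
    affine-block : ∀ i t u j → InBlock (affine i t (u +7 offset j)) (affine i t u +7 drift i)
    affine-block = toWitness {a? = all? λ i → all? λ t → all? λ u → all? λ j →
      inBlock? (affine i t (u +7 offset j)) (affine i t u +7 drift i)} tt

  opaque
    shift-zero : ∀ i t → shift i t (# 0) ≡ t
    shift-zero = toWitness {a? = all? λ i → all? λ t → shift i t (# 0) ≟ t} tt

  opaque
    shift-suc : ∀ i t u → shift i t u +7 drift i ≡ shift i t (u +7 # 1)
    shift-suc = toWitness {a? = all? λ i → all? λ t → all? λ u →
      (shift i t u +7 drift i) ≟ shift i t (u +7 # 1)} tt

  opaque
    shift-periodic : ∀ i t w → t ≡ shift i t w → i ≡ # 0 ⊎ w ≡ # 0
    shift-periodic = toWitness {a? = all? λ i → all? λ t → all? λ w →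
      (t ≟ shift i t w) →-dec ((i ≟ # 0) ⊎-dec (w ≟ # 0))} tt

  opaque
    affine-shift-suc : ∀ i t p y → affine i (shift i t (p +7 # 1)) y ≡ affine i (shift i t p) y +7 drift i
    affine-shift-suc = toWitness {a? = all? λ i → all? λ t → all? λ p → all? λ y →
      affine i (shift i t (p +7 # 1)) y ≟ (affine i (shift i t p) y +7 drift i)} tt

  ThreeOthers : Z7 → Z7 → Z7 → Z7 → Z7 → Set
  ThreeOthers u v w1 w2 w3 = w1 ≢ w2 × w1 ≢ w3 × w2 ≢ w3 ×
    w1 ≢ u × w2 ≢ u × w3 ≢ u × w1 ≢ v × w2 ≢ v × w3 ≢ v

  opaque
    threeOthers : ∀ u v → ∃ λ w1 → ∃ λ w2 → ∃ λ w3 → ThreeOthers u v w1 w2 w3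
    threeOthers = toWitness {a? = all? λ u → all? λ v → any? λ w1 → any? λ w2 → any? λ w3 →
      (w1 ≢? w2) ×-dec (w1 ≢? w3) ×-dec (w2 ≢? w3) ×-dec (w1 ≢? u) ×-dec (w2 ≢? u) ×-dec (w3 ≢? u)
      ×-dec (w1 ≢? v) ×-dec (w2 ≢? v) ×-dec (w3 ≢? v)} tt

  opaque
    affine-∘ : ∀ i j u v y → affine i u (affine j v y) ≡ affine (addC 3 i j) (u +7 pow2 i *7 v) y
    affine-∘ = toWitness {a? = all? λ i → all? λ j → all? λ u → all? λ v → all? λ y →
      affine i u (affine j v y) ≟ affine (addC 3 i j) (u +7 pow2 i *7 v) y} tt

  opaque
    shift-∘ : ∀ i j t t' p q → shift i t (p +7 q) +7 pow2 i *7 shift j t' p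
                              ≡ shift (addC 3 i j) (shift i (t +7 pow2 i *7 t') q) p
    shift-∘ = toWitness {a? = all? λ i → all? λ j → all? λ t → all? λ t' → all? λ p → all? λ q →
      (shift i t (p +7 q) +7 pow2 i *7 shift j t' p) ≟ shift (addC 3 i j) (shift i (t +7 pow2 i *7 t') q) p} tt

  opaque
    affine-id : ∀ p y → affine zero (shift zero zero p) y ≡ y
    affine-id = toWitness {a? = all? λ p → all? λ y → affine zero (shift zero zero p) y ≟ y} tt

  opaque
    shift-inverse : ∀ i t p → ∃ λ t' → shift (neg 3 i) (t' +7 pow2 (neg 3 i) *7 t) p ≡ # 0
                                     × shift i (t +7 pow2 i *7 t') (neg 7 p) ≡ # 0
    shift-inverse = toWitness {a? = all? λ i → all? λ t → all? λ p → any? λ t' →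
      (shift (neg 3 i) (t' +7 pow2 (neg 3 i) *7 t) p ≟ # 0)
      ×-dec (shift i (t +7 pow2 i *7 t') (neg 7 p) ≟ # 0)} tt

  opaque
    drift-neg : ∀ i p q → drift i *7 (p +7 q) ≡ # 0 → drift i *7 q ≡ drift i *7 neg 7 p
    drift-neg = toWitness {a? = all? λ i → all? λ p → all? λ q →
      ((drift i *7 (p +7 q)) ≟ # 0) →-dec ((drift i *7 q) ≟ (drift i *7 neg 7 p))} tt

  -- Recovering the parameters (i, t) of an affine map from its values.
  exponentOf : Z7 → Fin 3
  exponentOf (suc (suc zero)) = # 1
  exponentOf (suc (suc (suc (suc zero)))) = # 2
  exponentOf _ = # 0

  opaque
    affine-at-0 : ∀ i t → affine i t (# 0) ≡ t
    affine-at-0 = toWitness {a? = all? λ i → all? λ t → affine i t (# 0) ≟ t} tt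

  opaque
    exponentOf-affine : ∀ i t → exponentOf (sub 7 (affine i t (# 1)) t) ≡ i
    exponentOf-affine = toWitness {a? = all? λ i → all? λ t → exponentOf (sub 7 (affine i t (# 1)) t) ≟ i} tt

  -- The translation part, normalised by subtracting the reduced C_k-part,
  -- composes as in the semidirect product.
  opaque
    shift-semidirect : ∀ i t t' p q → sub 7 (shift i (t +7 pow2 i *7 t') q) (p +7 q)
                                     ≡ sub 7 t p +7 pow2 i *7 sub 7 t' q
    shift-semidirect = toWitness {a? = all? λ i → all? λ t → all? λ t' → all? λ p → all? λ q →
      sub 7 (shift i (t +7 pow2 i *7 t') q) (p +7 q) ≟ (sub 7 t p +7 pow2 i *7 sub 7 t' q)} tt

  opaque
    shift-trivial : ∀ t t' q → shift zero (t +7 pow2 zero *7 t') q ≡ t +7 t'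
    shift-trivial = toWitness {a? = all? λ t → all? λ t' → all? λ q → shift zero (t +7 pow2 zero *7 t') q ≟ (t +7 t')} tt

module Window where

  -- The common neighbours of an adjacent pair x = (a, p), y = (a+1, q)
  -- (with p in block q) live in the fibres a, a+1 and a+2; a common
  -- neighbour is recorded by its slot τ ∈ {0,1,2} (fibre a+τ) and its
  -- C_7-coordinate.  The finite check below shows that no three of them
  -- are pairwise collinear.

  open C7Facts
  open import Data.Empty using (⊥)
  open import Data.Fin using (Fin; zero; suc)
  open import Data.Fin.Properties using (_≟_; all?)
  open import Data.Product using (_×_; _,_)
  open import Data.Unit using (tt; ⊤)
  open import Relation.Nullary using (¬_; Dec; yes; no)
  open import Relation.Nullary.Decidable using (toWitness; ¬?; _×-dec_; _→-dec_)
  open import Relation.Binary.PropositionalEquality using (_≡_; _≢_)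

  Slot : Set
  Slot = Fin 3 × Z7

  CommonNeighbour : Z7 → Z7 → Slot → Set
  CommonNeighbour p q (zero , r) = InBlock r q × r ≢ p
  CommonNeighbour p q (suc zero , r) = InBlock p r × r ≢ q
  CommonNeighbour p q (suc (suc zero) , r) = InBlock r p × InBlock q r

  commonNeighbour? : ∀ p q z → Dec (CommonNeighbour p q z)
  commonNeighbour? p q (zero , r) = inBlock? r q ×-dec (r ≢? p)
  commonNeighbour? p q (suc zero , r) = inBlock? p r ×-dec (r ≢? q)
  commonNeighbour? p q (suc (suc zero) , r) = inBlock? r p ×-dec inBlock? q r

  -- what collinearity of two slots entails (fibre a+1 follows a, a+2 follows
  -- a+1, and a+2 can only meet a when it precedes it)
  SlotCollinear : Slot → Slot → Set
  SlotCollinear (zero , r) (suc zero , r') = InBlock r r'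
  SlotCollinear (suc zero , r) (zero , r') = InBlock r' r
  SlotCollinear (zero , r) (suc (suc zero) , r') = InBlock r' r
  SlotCollinear (suc (suc zero) , r) (zero , r') = InBlock r r'
  SlotCollinear (suc zero , r) (suc (suc zero) , r') = InBlock r r'
  SlotCollinear (suc (suc zero) , r) (suc zero , r') = InBlock r' r
  SlotCollinear _ _ = ⊤

  slotCollinear? : ∀ z z' → Dec (SlotCollinear z z')
  slotCollinear? (zero , r) (zero , r') = yes tt
  slotCollinear? (zero , r) (suc zero , r') = inBlock? r r'
  slotCollinear? (zero , r) (suc (suc zero) , r') = inBlock? r' r
  slotCollinear? (suc zero , r) (zero , r') = inBlock? r' r
  slotCollinear? (suc zero , r) (suc zero , r') = yes tt
  slotCollinear? (suc zero , r) (suc (suc zero) , r') = inBlock? r r'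
  slotCollinear? (suc (suc zero) , r) (zero , r') = inBlock? r r'
  slotCollinear? (suc (suc zero) , r) (suc zero , r') = inBlock? r' r
  slotCollinear? (suc (suc zero) , r) (suc (suc zero) , r') = yes tt

  SlotDistinct : Slot → Slot → Set
  SlotDistinct (τ , r) (τ' , r') = ¬ (τ ≡ τ' × r ≡ r')

  slotDistinct? : ∀ z z' → Dec (SlotDistinct z z')
  slotDistinct? (τ , r) (τ' , r') = ¬? ((τ ≟ τ') ×-dec (r ≟ r'))

  allSlots? : {P : Slot → Set} → (∀ z → Dec (P z)) → Dec (∀ z → P z)
  allSlots? {P} P? with all? (λ τ → all? (λ r → P? (τ , r)))
  ... | yes h = yes (λ (τ , r) → h τ r)
  ... | no h = no (λ h' → h (λ τ r → h' (τ , r)))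

  opaque
    no-three-common-neighbours : ∀ q p → InBlock p q →
      ∀ z1 → CommonNeighbour p q z1 → ∀ z2 → CommonNeighbour p q z2 →
      SlotDistinct z1 z2 → SlotCollinear z1 z2 →
      ∀ z3 → CommonNeighbour p q z3 → SlotDistinct z1 z3 → SlotDistinct z2 z3 →
      SlotCollinear z1 z3 → SlotCollinear z2 z3 → ⊥
    no-three-common-neighbours = toWitness {a? = all? λ q → all? λ p → inBlock? p q →-dec
      allSlots? λ z1 → commonNeighbour? p q z1 →-dec allSlots? λ z2 → commonNeighbour? p q z2 →-dec
      slotDistinct? z1 z2 →-dec slotCollinear? z1 z2 →-dec allSlots? λ z3 → commonNeighbour? p q z3 →-dec
      slotDistinct? z1 z3 →-dec slotDistinct? z2 z3 →-dec slotCollinear? z1 z3 →-dec slotCollinear? z2 z3 →-dec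
      no (λ ())} tt

module Fano where

  open C7Facts
  open import Data.Fin using (Fin; zero; suc; #_)
  open import Data.Product using (∃; _,_; proj₁; proj₂)
  open import Relation.Binary.PropositionalEquality using (_≡_; _≢_; refl; sym; trans; cong)

  fano-rigidity : (f g h : Z7 → Z7) → (∀ {y y'} → g y ≡ g y' → y ≡ y') →
                  PreservesBlocks f g → PreservesBlocks g h → ∃ λ i → ∀ y → g y ≡ affine i (g zero) y
  fano-rigidity f g h g-inj f↝g g↝h = i , λ y → trans (g-span y) (span-affine y)
    where
    g≢ : ∀ {u v} → u ≢ v → g u ≢ g v
    g≢ u≢v e = u≢v (g-inj e)

    -- the image of block c is the block h c, so two image points determine
    -- the third; dually for the blocks f y through the image of y
    third : ∀ c u v w j₁ j₂ j₃ → u ≡ c +7 offset j₁ → v ≡ c +7 offset j₂ → w ≡ c +7 offset j₃ →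
            u ≢ v → u ≢ w → v ≢ w → g w ≡ thirdOnBlock (g u) (g v)
    third c u v w j₁ j₂ j₃ eu ev ew d₁ d₂ d₃ =
      thirdOnBlock-unique (h c) (g u) (g↝h u c (j₁ , eu)) (g v) (g↝h v c (j₂ , ev)) (g w) (g↝h w c (j₃ , ew))
        (g≢ d₁) (g≢ d₂) (g≢ d₃)

    cothird : ∀ y u v w j₁ j₂ j₃ → y ≡ u +7 offset j₁ → y ≡ v +7 offset j₂ → y ≡ w +7 offset j₃ →
              u ≢ v → u ≢ w → v ≢ w → g w ≡ thirdOnCoblock (g u) (g v)
    cothird y u v w j₁ j₂ j₃ eu ev ew d₁ d₂ d₃ =
      thirdOnCoblock-unique (f y) (g u) (f↝g y u (j₁ , eu)) (g v) (f↝g y v (j₂ , ev)) (g w) (f↝g y w (j₃ , ew))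
        (g≢ d₁) (g≢ d₂) (g≢ d₃)

    g0 g1 : Z7
    g0 = g (# 0)
    g1 = g (# 1)

    -- block 0 = {0,1,3};  1 ∈ blocks 0, 1, 5;  block 4 = {4,5,0};
    -- 3 ∈ blocks 0, 3, 2;  block 6 = {6,0,2};  block 1 = {1,2,4}
    g3 : g (# 3) ≡ thirdOnBlock g0 g1
    g3 = third (# 0) (# 0) (# 1) (# 3) (# 0) (# 1) (# 2) refl refl refl (λ ()) (λ ()) (λ ())

    g5 : g (# 5) ≡ thirdOnCoblock g0 g1
    g5 = cothird (# 1) (# 0) (# 1) (# 5) (# 1) (# 0) (# 2) refl refl refl (λ ()) (λ ()) (λ ())

    g4 : g (# 4) ≡ thirdOnBlock g0 (g (# 5))
    g4 = third (# 4) (# 0) (# 5) (# 4) (# 2) (# 1) (# 0) refl refl refl (λ ()) (λ ()) (λ ())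

    g2 : g (# 2) ≡ thirdOnCoblock g0 (g (# 3))
    g2 = cothird (# 3) (# 0) (# 3) (# 2) (# 2) (# 0) (# 1) refl refl refl (λ ()) (λ ()) (λ ())

    g6 : g (# 6) ≡ thirdOnBlock g0 (g (# 2))
    g6 = third (# 6) (# 0) (# 2) (# 6) (# 1) (# 2) (# 0) refl refl refl (λ ()) (λ ()) (λ ())

    g4' : g (# 4) ≡ thirdOnBlock g1 (g (# 2))
    g4' = third (# 1) (# 1) (# 2) (# 4) (# 0) (# 1) (# 2) refl refl refl (λ ()) (λ ()) (λ ())

    g2-span : g (# 2) ≡ thirdOnCoblock g0 (thirdOnBlock g0 g1)
    g2-span = trans g2 (cong (thirdOnCoblock g0) g3)

    g4-span : g (# 4) ≡ thirdOnBlock g0 (thirdOnCoblock g0 g1)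
    g4-span = trans g4 (cong (thirdOnBlock g0) g5)

    g4-span' : g (# 4) ≡ thirdOnBlock g1 (thirdOnCoblock g0 (thirdOnBlock g0 g1))
    g4-span' = trans g4' (cong (thirdOnBlock g1) g2-span)

    g-span : ∀ y → g y ≡ fanoSpan g0 g1 y
    g-span zero = refl
    g-span (suc zero) = refl
    g-span (suc (suc zero)) = g2-span
    g-span (suc (suc (suc zero))) = g3
    g-span (suc (suc (suc (suc zero)))) = g4-span
    g-span (suc (suc (suc (suc (suc zero))))) = g5
    g-span (suc (suc (suc (suc (suc (suc zero)))))) = trans g6 (cong (thirdOnBlock g0) g2-span)

    affineSpan : ∃ λ i → ∀ y → fanoSpan g0 g1 y ≡ affine i g0 y
    affineSpan = fanoSpan-affine g0 g1 (g≢ (λ ())) (trans (sym g4-span) g4-span')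

    i : Fin 3
    i = proj₁ affineSpan

    span-affine : ∀ y → fanoSpan g0 g1 y ≡ affine i g0 y
    span-affine = proj₂ affineSpan

module Incidence (k : ℕ) .{{_ : NonZero k}} (3≤k : 3 ≤ k) where

  -- Incidence of D(C_k ⊕ C_7, D) in fibre coordinates: the line b = (a, c)
  -- meets the fibre {a} × C_7 in the block c + {0,1,3} and the fibre
  -- {a+1} × C_7 in the single point (a+1, c), its tip.

  open ModArith
  open C7Facts
  open import Data.Nat using (_<_; s≤s; z≤n)
  open import Data.Nat.Properties using (<-≤-trans)
  open import Data.Fin using (Fin; zero; suc)
  open import Data.Product using (Σ; ∃; _×_; _,_; proj₁; proj₂)
  open import Data.Sum using (_⊎_; inj₁; inj₂)
  open import Data.Empty using (⊥-elim)
  open import Function.Bundles using (mk⇔; Equivalence)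
  open import Relation.Binary.PropositionalEquality using (_≡_; _≢_; refl; sym; trans; cong; subst)
  open Equivalence

  0<k : 0 < k
  0<k = <-≤-trans (s≤s z≤n) 3≤k

  1<k : 1 < k
  1<k = <-≤-trans (s≤s (s≤s z≤n)) 3≤k

  opaque
    next : Fin k → Fin k
    next a = addC k a (1̂ k)

    next-def : ∀ a → next a ≡ addC k a (1̂ k)
    next-def a = refl

    -- since k ≥ 3, a, a+1 and a+2 are pairwise distinct
    next-≢ : ∀ a → next a ≢ a
    next-≢ a e with ofℕ-injective k 1<k 0<k (add-stable⇒zero k a (1̂ k) e)
    ... | ()

    next²-≢ : ∀ a → next (next a) ≢ a
    next²-≢ a e with ofℕ-injective k 3≤k 0<k (add-stable⇒zero k a (ofℕ k 2) a+2≡a)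
      where
      a+2≡a : addC k a (ofℕ k 2) ≡ a
      a+2≡a = trans (sym (trans (add-assoc k a (1̂ k) (1̂ k)) (cong (addC k a) (add-ofℕ k 1 1)))) e
    ... | ()

    next-injective : ∀ {a b} → next a ≡ next b → a ≡ b
    next-injective {a} {b} = add-cancelʳ k (1̂ k) a b

    next-surjective : ∀ a → ∃ λ b → next b ≡ a
    next-surjective a = addC k a (neg k (1̂ k)) ,
      trans (add-assoc k a (neg k (1̂ k)) (1̂ k)) (trans (cong (addC k a) (add-negˡ k (1̂ k))) (add-zeroʳ k a))

  fibre : G k → Fin k
  fibre = proj₁

  coord : G k → Z7
  coord = proj₂

  pair-≡ : ∀ {x y : G k} → fibre x ≡ fibre y → coord x ≡ coord y → x ≡ y
  pair-≡ refl refl = refl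

  SameFibre : G k → G k → Set
  SameFibre x z = fibre x ≡ fibre z

  IncN : G k → G k → Set
  IncN x b = (fibre x ≡ fibre b × InBlock (coord x) (coord b))
           ⊎ (fibre x ≡ next (fibre b) × coord x ≡ coord b)

  -- (0,0), (0,1), (0,3) ∈ D give the block of b, (1,0) gives its tip
  Inc⇒IncN : ∀ x b → Inc k x b → IncN x b
  Inc⇒IncN .(_⊕_ k b d) b (d , inj₁ refl , refl) = inj₁ (add-zeroʳ k (fibre b) , zero , refl)
  Inc⇒IncN .(_⊕_ k b d) b (d , inj₂ (inj₁ refl) , refl) = inj₁ (add-zeroʳ k (fibre b) , suc zero , refl)
  Inc⇒IncN .(_⊕_ k b d) b (d , inj₂ (inj₂ (inj₁ refl)) , refl) = inj₁ (add-zeroʳ k (fibre b) , suc (suc zero) , refl)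
  Inc⇒IncN .(_⊕_ k b d) b (d , inj₂ (inj₂ (inj₂ refl)) , refl) = inj₂ (sym (next-def (fibre b)) , add-zeroʳ 7 (coord b))

  IncN⇒Inc : ∀ x b → IncN x b → Inc k x b
  IncN⇒Inc x b (inj₁ (e , zero , e')) = el k 0 0 , inj₁ refl , pair-≡ (trans e (sym (add-zeroʳ k (fibre b)))) e'
  IncN⇒Inc x b (inj₁ (e , suc zero , e')) = el k 0 1 , inj₂ (inj₁ refl) , pair-≡ (trans e (sym (add-zeroʳ k (fibre b)))) e'
  IncN⇒Inc x b (inj₁ (e , suc (suc zero) , e')) =
    el k 0 3 , inj₂ (inj₂ (inj₁ refl)) , pair-≡ (trans e (sym (add-zeroʳ k (fibre b)))) e'
  IncN⇒Inc x b (inj₂ (e , e')) =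
    el k 1 0 , inj₂ (inj₂ (inj₂ refl)) , pair-≡ (trans e (next-def (fibre b))) (trans e' (sym (add-zeroʳ 7 (coord b))))

  tip : G k → G k
  tip b = next (fibre b) , coord b

  inc-base : ∀ b → Inc k b b
  inc-base b = IncN⇒Inc b b (inj₁ (refl , zero , sym (add-zeroʳ 7 (coord b))))

  inc-tip : ∀ b → Inc k (tip b) b
  inc-tip b = IncN⇒Inc (tip b) b (inj₂ (refl , refl))

  line-determined : ∀ b c → Inc k b c → Inc k (tip b) c → b ≡ c
  line-determined b c i j = cases (Inc⇒IncN b c i) (Inc⇒IncN (tip b) c j)
    where
    cases : IncN b c → IncN (tip b) c → b ≡ c
    cases (inj₁ (e , _)) (inj₁ (f , _)) = ⊥-elim (next-≢ _ (trans f (sym e)))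
    cases (inj₁ (e , _)) (inj₂ (_ , f)) = pair-≡ e f
    cases (inj₂ (e , _)) (inj₁ (f , _)) = ⊥-elim (next²-≢ (fibre c) (trans (cong next (sym e)) f))
    cases (inj₂ (e , _)) (inj₂ (f , _)) = ⊥-elim (next-≢ (fibre c) (trans (sym e) (next-injective f)))

  line-inverse : ∀ (f g f̂ ĝ : G k → G k) → (∀ x → f (g x) ≡ x) →
    (∀ {x b} → Inc k x b → Inc k (g x) (ĝ b)) → (∀ {x b} → Inc k x b → Inc k (f x) (f̂ b)) →
    ∀ b → f̂ (ĝ b) ≡ b
  line-inverse f g f̂ ĝ fg gInc fInc b = sym (line-determined b (f̂ (ĝ b))
    (subst (λ v → Inc k v (f̂ (ĝ b))) (fg b) (fInc (gInc (inc-base b))))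
    (subst (λ v → Inc k v (f̂ (ĝ b))) (fg (tip b)) (fInc (gInc (inc-tip b)))))

  ~⇒≡ : ∀ b c → _~_ k b c → b ≡ c
  ~⇒≡ b c e = line-determined b c (to (e b) (inc-base b)) (to (e (tip b)) (inc-tip b))

  ≡⇒~ : ∀ {b c} → b ≡ c → _~_ k b c
  ≡⇒~ refl x = mk⇔ (λ i → i) (λ i → i)

  Collinear : G k → G k → Set
  Collinear x z = Σ (G k) λ b → Inc k x b × Inc k z b

  Adjacent : G k → G k → Set
  Adjacent x z = next (fibre x) ≡ fibre z × InBlock (coord x) (coord z)

  collinear-cases : ∀ x z → Collinear x z → SameFibre x z ⊎ Adjacent x z ⊎ Adjacent z x
  collinear-cases x z (b , i , j) = cases (Inc⇒IncN x b i) (Inc⇒IncN z b j)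
    where
    cases : IncN x b → IncN z b → SameFibre x z ⊎ Adjacent x z ⊎ Adjacent z x
    cases (inj₁ (e , _)) (inj₁ (f , _)) = inj₁ (trans e (sym f))
    cases (inj₁ (e , r)) (inj₂ (f , f')) = inj₂ (inj₁ (trans (cong next e) (sym f) , subst (InBlock (coord x)) (sym f') r))
    cases (inj₂ (e , e')) (inj₁ (f , r)) = inj₂ (inj₂ (trans (cong next f) (sym e) , subst (InBlock (coord z)) (sym e') r))
    cases (inj₂ (e , _)) (inj₂ (f , _)) = inj₁ (trans e (sym f))

  -- Two points of one fibre are always collinear (any two points of C_7
  -- lie in a common block).
  sameFibre⇒collinear : ∀ x z → SameFibre x z → Collinear x z
  sameFibre⇒collinear x z e with commonBlock (coord x) (coord z)
  ... | c , r , r' = (fibre x , c) , IncN⇒Inc x (fibre x , c) (inj₁ (refl , r)) , IncN⇒Inc z (fibre x , c) (inj₁ (sym e , r'))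

module FibrePreservation (k : ℕ) .{{_ : NonZero k}} (3≤k : 3 ≤ k) where

  -- Two distinct points of a fibre have three further
  -- common neighbours that are pairwise collinear (a clique), while two
  -- collinear points in adjacent fibres have no such clique.

  open Incidence k 3≤k
  open C7Facts
  open Window
  open import Data.Fin using (Fin; zero; suc)
  open import Data.Fin.Properties using () renaming (_≟_ to _≟F_)
  open import Data.Product using (Σ; _×_; _,_)
  open import Data.Product.Properties using (≡-dec)
  open import Data.Sum using (inj₁; inj₂)
  open import Data.Empty using (⊥-elim)
  open import Data.Unit using (tt)
  open import Relation.Nullary using (¬_; yes; no)
  open import Relation.Binary.PropositionalEquality using (_≡_; _≢_; refl; sym; trans; cong)

  record Clique (x y : G k) : Set where
    field
      z1 z2 z3 : G k
      d12 : z1 ≢ z2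
      d13 : z1 ≢ z3
      d23 : z2 ≢ z3
      d1x : z1 ≢ x
      d2x : z2 ≢ x
      d3x : z3 ≢ x
      d1y : z1 ≢ y
      d2y : z2 ≢ y
      d3y : z3 ≢ y
      c1x : Collinear z1 x
      c2x : Collinear z2 x
      c3x : Collinear z3 x
      c1y : Collinear z1 y
      c2y : Collinear z2 y
      c3y : Collinear z3 y
      c12 : Collinear z1 z2
      c13 : Collinear z1 z3
      c23 : Collinear z2 z3

  clique-swap : ∀ {x y} → Clique x y → Clique y x
  clique-swap c = record { Clique c ; d1x = d1y ; d2x = d2y ; d3x = d3y ; d1y = d1x ; d2y = d2x ; d3y = d3x
                         ; c1x = c1y ; c2x = c2y ; c3x = c3y ; c1y = c1x ; c2y = c2x ; c3y = c3x }
    where open Clique c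

  clique-map : (h : G k → G k) → (∀ {x y} → h x ≡ h y → x ≡ y) → (∀ {x y} → Collinear x y → Collinear (h x) (h y)) →
               ∀ {x y} → Clique x y → Clique (h x) (h y)
  clique-map h inj col c = record
    { z1 = h z1 ; z2 = h z2 ; z3 = h z3
    ; d12 = λ e → d12 (inj e) ; d13 = λ e → d13 (inj e) ; d23 = λ e → d23 (inj e)
    ; d1x = λ e → d1x (inj e) ; d2x = λ e → d2x (inj e) ; d3x = λ e → d3x (inj e)
    ; d1y = λ e → d1y (inj e) ; d2y = λ e → d2y (inj e) ; d3y = λ e → d3y (inj e)
    ; c1x = col c1x ; c2x = col c2x ; c3x = col c3x ; c1y = col c1y ; c2y = col c2y ; c3y = col c3y
    ; c12 = col c12 ; c13 = col c13 ; c23 = col c23 }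
    where open Clique c

  -- inside a fibre every pair is collinear, so any three other points do
  sameFibre-clique : ∀ x y → SameFibre x y → x ≢ y → Clique x y
  sameFibre-clique (a , u) (a' , v) refl _ with threeOthers u v
  ... | w1 , w2 , w3 , p12 , p13 , p23 , p1u , p2u , p3u , p1v , p2v , p3v = record
    { z1 = a , w1 ; z2 = a , w2 ; z3 = a , w3
    ; d12 = λ e → p12 (cong coord e) ; d13 = λ e → p13 (cong coord e) ; d23 = λ e → p23 (cong coord e)
    ; d1x = λ e → p1u (cong coord e) ; d2x = λ e → p2u (cong coord e) ; d3x = λ e → p3u (cong coord e)
    ; d1y = λ e → p1v (cong coord e) ; d2y = λ e → p2v (cong coord e) ; d3y = λ e → p3v (cong coord e)
    ; c1x = same ; c2x = same ; c3x = same ; c1y = same ; c2y = same ; c3y = same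
    ; c12 = same ; c13 = same ; c23 = same }
    where
    same : ∀ {w w'} → Collinear (a , w) (a , w')
    same = sameFibre⇒collinear _ _ refl

  module AdjacentPair (a : Fin k) (p q : Z7) where

    fibreOfSlot : Fin 3 → Fin k
    fibreOfSlot zero = a
    fibreOfSlot (suc zero) = next a
    fibreOfSlot (suc (suc zero)) = next (next a)

    AtSlot : Slot → G k → Set
    AtSlot (τ , r) z = fibre z ≡ fibreOfSlot τ × coord z ≡ r

    toSlot : ∀ z → Collinear z (a , p) → Collinear z (next a , q) → z ≢ (a , p) → z ≢ (next a , q) →
             Σ Slot λ l → CommonNeighbour p q l × AtSlot l z
    toSlot z cx cy dx dy with collinear-cases z (a , p) cx | collinear-cases z (next a , q) cy
    ... | inj₁ e | inj₁ f = ⊥-elim (next-≢ a (trans (sym f) e))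
    ... | inj₁ e | inj₂ (inj₁ (_ , r)) = (zero , coord z) , (r , λ e' → dx (pair-≡ e e')) , e , refl
    ... | inj₁ e | inj₂ (inj₂ (f , _)) = ⊥-elim (next²-≢ a (trans f e))
    ... | inj₂ (inj₁ (e , _)) | inj₁ f = ⊥-elim (next²-≢ a (trans (cong next (sym f)) e))
    ... | inj₂ (inj₁ (e , _)) | inj₂ (inj₁ (f , _)) = ⊥-elim (next-≢ a (trans (cong next (sym (next-injective f))) e))
    ... | inj₂ (inj₁ (_ , r)) | inj₂ (inj₂ (f , r')) = (suc (suc zero) , coord z) , (r , r') , sym f , refl
    ... | inj₂ (inj₂ (_ , r)) | inj₁ f = (suc zero , coord z) , (r , λ e' → dy (pair-≡ f e')) , f , refl
    ... | inj₂ (inj₂ (e , _)) | inj₂ (inj₁ (f , _)) = ⊥-elim (next-≢ a (trans e (next-injective f)))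
    ... | inj₂ (inj₂ (e , _)) | inj₂ (inj₂ (f , _)) = ⊥-elim (next-≢ a (sym (next-injective (trans e (sym f)))))

    -- collinearity between slots: the impossible fibre configurations are
    -- excluded because a, a+1, a+2 are pairwise distinct
    slotCollinear : ∀ l l' z z' → AtSlot l z → AtSlot l' z' → Collinear z z' → SlotCollinear l l'
    slotCollinear (zero , _) (zero , _) _ _ _ _ _ = tt
    slotCollinear (suc zero , _) (suc zero , _) _ _ _ _ _ = tt
    slotCollinear (suc (suc zero) , _) (suc (suc zero) , _) _ _ _ _ _ = tt
    slotCollinear (zero , _) (suc zero , _) _ _ (refl , refl) (refl , refl) c with collinear-cases _ _ c
    ... | inj₁ e = ⊥-elim (next-≢ a (sym e))
    ... | inj₂ (inj₁ (_ , r)) = r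
    ... | inj₂ (inj₂ (e , _)) = ⊥-elim (next²-≢ a e)
    slotCollinear (suc zero , _) (zero , _) _ _ (refl , refl) (refl , refl) c with collinear-cases _ _ c
    ... | inj₁ e = ⊥-elim (next-≢ a e)
    ... | inj₂ (inj₁ (e , _)) = ⊥-elim (next²-≢ a e)
    ... | inj₂ (inj₂ (_ , r)) = r
    slotCollinear (zero , _) (suc (suc zero) , _) _ _ (refl , refl) (refl , refl) c with collinear-cases _ _ c
    ... | inj₁ e = ⊥-elim (next²-≢ a (sym e))
    ... | inj₂ (inj₁ (e , _)) = ⊥-elim (next-≢ a (sym (next-injective e)))
    ... | inj₂ (inj₂ (_ , r)) = r
    slotCollinear (suc (suc zero) , _) (zero , _) _ _ (refl , refl) (refl , refl) c with collinear-cases _ _ c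
    ... | inj₁ e = ⊥-elim (next²-≢ a e)
    ... | inj₂ (inj₁ (_ , r)) = r
    ... | inj₂ (inj₂ (e , _)) = ⊥-elim (next-≢ a (sym (next-injective e)))
    slotCollinear (suc zero , _) (suc (suc zero) , _) _ _ (refl , refl) (refl , refl) c with collinear-cases _ _ c
    ... | inj₁ e = ⊥-elim (next-≢ a (sym (next-injective e)))
    ... | inj₂ (inj₁ (_ , r)) = r
    ... | inj₂ (inj₂ (e , _)) = ⊥-elim (next²-≢ a (next-injective e))
    slotCollinear (suc (suc zero) , _) (suc zero , _) _ _ (refl , refl) (refl , refl) c with collinear-cases _ _ c
    ... | inj₁ e = ⊥-elim (next-≢ a (next-injective e))
    ... | inj₂ (inj₁ (e , _)) = ⊥-elim (next²-≢ a (next-injective e))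
    ... | inj₂ (inj₂ (_ , r)) = r

    slotDistinct : ∀ l l' z z' → AtSlot l z → AtSlot l' z' → z ≢ z' → SlotDistinct l l'
    slotDistinct (τ , r) (.τ , .r) z z' (e , e') (f , f') d (refl , refl) = d (pair-≡ (trans e (sym f)) (trans e' (sym f')))

    no-clique : InBlock p q → ¬ Clique (a , p) (next a , q)
    no-clique r c with toSlot z1 c1x c1y d1x d1y | toSlot z2 c2x c2y d2x d2y | toSlot z3 c3x c3y d3x d3y
      where open Clique c
    ... | l1 , n1 , s1 | l2 , n2 , s2 | l3 , n3 , s3 =
      no-three-common-neighbours q p r l1 n1 l2 n2 (slotDistinct l1 l2 z1 z2 s1 s2 d12) (slotCollinear l1 l2 z1 z2 s1 s2 c12)
        l3 n3 (slotDistinct l1 l3 z1 z3 s1 s3 d13) (slotDistinct l2 l3 z2 z3 s2 s3 d23)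
        (slotCollinear l1 l3 z1 z3 s1 s3 c13) (slotCollinear l2 l3 z2 z3 s2 s3 c23)
      where open Clique c

  adjacent-no-clique : ∀ x y → Adjacent x y → ¬ Clique x y
  adjacent-no-clique (a , p) (.(next a) , q) (refl , r) = AdjacentPair.no-clique a p q r

  -- the image of a same-fibre pair is collinear; it cannot be an adjacent pair
  -- since it has a clique, so it lies in one fibre
  fibre-preserved : (h : G k → G k) → (∀ {x y} → h x ≡ h y → x ≡ y) → (∀ {x y} → Collinear x y → Collinear (h x) (h y)) →
                    ∀ x y → SameFibre x y → SameFibre (h x) (h y)
  fibre-preserved h inj col x y e with ≡-dec _≟F_ _≟F_ x y
  ... | yes refl = refl
  ... | no x≢y with collinear-cases (h x) (h y) (col (sameFibre⇒collinear x y e))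
  ...   | inj₁ s = s
  ...   | inj₂ (inj₁ adj) = ⊥-elim (adjacent-no-clique _ _ adj (clique-map h inj col (sameFibre-clique x y e x≢y)))
  ...   | inj₂ (inj₂ adj) = ⊥-elim (adjacent-no-clique _ _ adj (clique-swap (clique-map h inj col (sameFibre-clique x y e x≢y))))

module AffineFamily (k : ℕ) .{{_ : NonZero k}} (3≤k : 3 ≤ k) where

  -- The candidate automorphisms
  --   (a, y) ↦ (a + s, 2^i y + t + drift i · π a),
  -- where π : C_k → C_7 is reduction mod 7.  The image of the line (a, c) is
  -- then a line again provided drift i · π is additive, i.e. i = 0 or 7 ∣ k.

  open Incidence k 3≤k
  open ModArith
  open C7Facts
  open import Data.Nat.Properties using (*-zeroʳ)
  open import Data.Nat.DivMod using (m<n⇒m%n≡m)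
  open import Data.Nat.Divisibility using (_∣_)
  open import Data.Fin using (Fin; zero; toℕ; #_)
  open import Data.Product using (_,_; proj₁; proj₂)
  open import Data.Sum using (_⊎_; inj₁; inj₂)
  open import Function.Bundles using (mk⇔)
  open import Relation.Binary.PropositionalEquality using (_≡_; refl; sym; trans; cong; cong₂; subst₂; module ≡-Reasoning)

  -- reduction mod 7 (a homomorphism only when 7 ∣ k)
  π : Fin k → Z7
  π = reduce k 7

  affineMap : Fin 3 → Fin k → Z7 → G k → G k
  affineMap i s t (a , y) = addC k a s , affine i (shift i t (π a)) y

  lineMap : Fin 3 → Fin k → Z7 → G k → G k
  lineMap i s t (a , c) = addC k a s , affine i (shift i t (π a)) c +7 drift i

  Admissible : Fin 3 → Set
  Admissible i = i ≡ zero ⊎ 7 ∣ k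

  admissible-neg : ∀ i → Admissible i → Admissible (neg 3 i)
  admissible-neg .zero (inj₁ refl) = inj₁ refl
  admissible-neg i (inj₂ 7∣k) = inj₂ 7∣k

  drift-additive : ∀ i → Admissible i → ∀ a s → drift i *7 π (addC k a s) ≡ drift i *7 (π a +7 π s)
  drift-additive .zero (inj₁ refl) a s = refl
  drift-additive i (inj₂ 7∣k) a s = cong (drift i *7_) (reduce-add k 7 7∣k a s)

  π-zero : π (0̂ k) ≡ # 0
  π-zero = cong (ofℕ 7) (trans (toℕ-ofℕ k 0) (m<n⇒m%n≡m 0<k))

  π-one : π (1̂ k) ≡ # 1
  π-one = cong (ofℕ 7) (trans (toℕ-ofℕ k 1) (m<n⇒m%n≡m 1<k))

  next-add : ∀ a s → next (addC k a s) ≡ addC k (next a) s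
  next-add a s = begin
      next (addC k a s)                   ≡⟨ next-def _ ⟩
      addC k (addC k a s) (1̂ k)           ≡⟨ add-assoc k a s (1̂ k) ⟩
      addC k a (addC k s (1̂ k))           ≡⟨ cong (addC k a) (add-comm k s (1̂ k)) ⟩
      addC k a (addC k (1̂ k) s)           ≡⟨ sym (add-assoc k a (1̂ k) s) ⟩
      addC k (addC k a (1̂ k)) s           ≡⟨ cong (λ u → addC k u s) (sym (next-def a)) ⟩
      addC k (next a) s                   ∎
    where open ≡-Reasoning

  shift-next : ∀ i → Admissible i → ∀ t a → shift i t (π (next a)) ≡ shift i t (π a +7 # 1)
  shift-next i ok t a = cong (t +7_) (trans (cong (λ u → drift i *7 π u) (next-def a))
                                     (trans (drift-additive i ok a (1̂ k)) (cong (λ u → drift i *7 (π a +7 u)) π-one)))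

  affineMap-incidenceN : ∀ i s t → Admissible i → ∀ x b → IncN x b → IncN (affineMap i s t x) (lineMap i s t b)
  affineMap-incidenceN i s t ok (.a , .(c +7 offset j)) (a , c) (inj₁ (refl , j , refl)) =
    inj₁ (refl , affine-block i (shift i t (π a)) c j)
  affineMap-incidenceN i s t ok (.(next a) , .c) (a , c) (inj₂ (refl , refl)) =
    inj₂ (sym (next-add a s) ,
          trans (cong (λ u → affine i u c) (shift-next i ok t a)) (affine-shift-suc i t (π a) c))

  affineMap-incidence : ∀ i s t → Admissible i → ∀ {x b} → Inc k x b → Inc k (affineMap i s t x) (lineMap i s t b)
  affineMap-incidence i s t ok {x} {b} h = IncN⇒Inc _ _ (affineMap-incidenceN i s t ok x b (Inc⇒IncN x b h))

  affineMap-∘ : ∀ i j s t s' t' → Admissible i → ∀ x →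
    affineMap i s t (affineMap j s' t' x) ≡ affineMap (addC 3 i j) (addC k s' s) (shift i (t +7 pow2 i *7 t') (π s')) x
  affineMap-∘ i j s t s' t' ok (a , y) = pair-≡ (add-assoc k a s' s)
    (trans (affine-∘ i j _ _ y) (cong (λ u → affine (addC 3 i j) u y)
       (trans (cong (λ u → t +7 u +7 pow2 i *7 shift j t' (π a)) (drift-additive i ok a s'))
              (shift-∘ i j t t' (π a) (π s')))))

  affineMap-id : ∀ x → affineMap zero (0̂ k) (# 0) x ≡ x
  affineMap-id (a , y) = pair-≡ (add-zeroʳ k a) (affine-id (π a) y)

  module Automorphism (i : Fin 3) (s : Fin k) (t : Z7) (ok : Admissible i) where
    i' : Fin 3
    i' = neg 3 i
    s' : Fin k
    s' = neg k s
    t' : Z7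
    t' = proj₁ (shift-inverse i t (π s))
    ok' : Admissible i'
    ok' = admissible-neg i ok

    drift-π-neg : drift i *7 π s' ≡ drift i *7 neg 7 (π s)
    drift-π-neg = drift-neg i (π s) (π s') (trans (sym (drift-additive i ok s s'))
      (trans (cong (λ u → drift i *7 π u) (add-negʳ k s))
             (trans (cong (drift i *7_) π-zero) (cong (ofℕ 7) (*-zeroʳ (toℕ (drift i)))))))

    left-inverse : ∀ x → affineMap i' s' t' (affineMap i s t x) ≡ x
    left-inverse x = trans (affineMap-∘ i' i s' t' s t ok' x)
      (trans (cong₂ (λ u v → affineMap u v (shift i' (t' +7 pow2 i' *7 t) (π s)) x) (add-negˡ 3 i) (add-negʳ k s))
      (trans (cong (λ u → affineMap zero (0̂ k) u x) (proj₁ (proj₂ (shift-inverse i t (π s))))) (affineMap-id x)))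

    right-inverse : ∀ x → affineMap i s t (affineMap i' s' t' x) ≡ x
    right-inverse x = trans (affineMap-∘ i i' s t s' t' ok x)
      (trans (cong₂ (λ u v → affineMap u v (shift i (t +7 pow2 i *7 t') (π s')) x) (add-negʳ 3 i) (add-negˡ k s))
      (trans (cong (λ u → affineMap zero (0̂ k) u x)
                   (trans (cong (t +7 pow2 i *7 t' +7_) drift-π-neg) (proj₂ (proj₂ (shift-inverse i t (π s))))))
             (affineMap-id x)))

    line-left-inverse : ∀ b → lineMap i' s' t' (lineMap i s t b) ≡ b
    line-left-inverse = line-inverse (affineMap i' s' t') (affineMap i s t) (lineMap i' s' t') (lineMap i s t) left-inverse (affineMap-incidence i s t ok) (affineMap-incidence i' s' t' ok')

    line-right-inverse : ∀ b → lineMap i s t (lineMap i' s' t' b) ≡ b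
    line-right-inverse = line-inverse (affineMap i s t) (affineMap i' s' t') (lineMap i s t) (lineMap i' s' t') right-inverse (affineMap-incidence i' s' t' ok') (affineMap-incidence i s t ok)

    aut : Aut k
    aut = record
      { α = affineMap i s t
      ; α⁻ = affineMap i' s' t'
      ; α⁻α = left-inverse
      ; αα⁻ = right-inverse
      ; β = lineMap i s t
      ; β⁻ = lineMap i' s' t'
      ; β-resp = λ b c e → ≡⇒~ (cong (lineMap i s t) (~⇒≡ b c e))
      ; β⁻-resp = λ b c e → ≡⇒~ (cong (lineMap i' s' t') (~⇒≡ b c e))
      ; β⁻β = λ b → ≡⇒~ (line-left-inverse b)
      ; ββ⁻ = λ b → ≡⇒~ (line-right-inverse b)
      ; incid = λ x b → mk⇔ (affineMap-incidence i s t ok)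
          (λ h → subst₂ (Inc k) (left-inverse x) (line-left-inverse b) (affineMap-incidence i' s' t' ok' h))
      }

module Classification (k : ℕ) .{{_ : NonZero k}} (3≤k : 3 ≤ k) where

  open Incidence k 3≤k
  open FibrePreservation k 3≤k
  open AffineFamily k 3≤k
  open ModArith
  open C7Facts
  open Fano
  open import Data.Nat using (zero; suc)
  open import Data.Nat.Divisibility using (m%n≡0⇒n∣m)
  open import Data.Fin using (Fin; toℕ; #_)
  open import Data.Product using (Σ; ∃; _×_; _,_; proj₁; proj₂)
  open import Data.Sum using (inj₁; inj₂)
  open import Data.Empty using (⊥-elim)
  open import Relation.Nullary using (¬_)
  open import Function.Bundles using (Equivalence)
  open import Relation.Binary.PropositionalEquality using (_≡_; refl; sym; trans; cong; subst; subst₂; module ≡-Reasoning)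
  open Equivalence

  Acts : Aut k → Fin 3 → Fin k → Z7 → Set
  Acts f i s t = ∀ x → α f x ≡ affineMap i s t x

  module _ (f : Aut k) where

    α-injective : ∀ {x y} → α f x ≡ α f y → x ≡ y
    α-injective {x} {y} e = trans (sym (α⁻α f x)) (trans (cong (α⁻ f) e) (α⁻α f y))

    α⁻-injective : ∀ {x y} → α⁻ f x ≡ α⁻ f y → x ≡ y
    α⁻-injective {x} {y} e = trans (sym (αα⁻ f x)) (trans (cong (α f) e) (αα⁻ f y))

    α-incidence : ∀ {x b} → Inc k x b → Inc k (α f x) (β f b)
    α-incidence {x} {b} = to (incid f x b)

    α⁻-incidence : ∀ {u b} → Inc k u b → Inc k (α⁻ f u) (β⁻ f b)
    α⁻-incidence {u} {b} i = from (incid f (α⁻ f u) (β⁻ f b))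
      (subst (λ v → Inc k v (β f (β⁻ f b))) (sym (αα⁻ f u)) (from (ββ⁻ f b u) i))

    α-collinear : ∀ {x y} → Collinear x y → Collinear (α f x) (α f y)
    α-collinear (b , i , j) = β f b , α-incidence i , α-incidence j

    α⁻-collinear : ∀ {x y} → Collinear x y → Collinear (α⁻ f x) (α⁻ f y)
    α⁻-collinear (b , i , j) = β⁻ f b , α⁻-incidence i , α⁻-incidence j

    -- α preserves fibres, and so does its inverse, so α also preserves
    -- being in different fibres
    α-sameFibre : ∀ x y → SameFibre x y → SameFibre (α f x) (α f y)
    α-sameFibre = fibre-preserved (α f) α-injective α-collinear

    α-crossFibre : ∀ x y → ¬ SameFibre x y → ¬ SameFibre (α f x) (α f y)
    α-crossFibre x y ne s =
      ne (subst₂ SameFibre (α⁻α f x) (α⁻α f y) (fibre-preserved (α⁻ f) α⁻-injective α⁻-collinear _ _ s))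

    -- The line b = (a, c): the images of its block lie in the block of the
    -- image line β b, and the image of its tip is the tip of β b, since the
    -- tip is the only point of b outside the fibre a.
    module OnLine (a : Fin k) (c : Z7) where
      b : G k
      b = a , c

      blockPoint : Fin 3 → G k
      blockPoint j = a , c +7 offset j

      block-incN : ∀ j → IncN (α f (blockPoint j)) (β f b)
      block-incN j = Inc⇒IncN _ _ (α-incidence (IncN⇒Inc (blockPoint j) b (inj₁ (refl , j , refl))))

      tip-incN : IncN (α f (tip b)) (β f b)
      tip-incN = Inc⇒IncN _ _ (α-incidence (inc-tip b))

      block-tip-apart : ∀ j → ¬ SameFibre (α f (blockPoint j)) (α f (tip b))
      block-tip-apart j = α-crossFibre (blockPoint j) (tip b) (λ e → next-≢ a (sym e))

      tip-image : α f (tip b) ≡ tip (β f b)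
      tip-image with tip-incN
      ... | inj₂ (e , e') = pair-≡ e e'
      ... | inj₁ (e , _) with block-incN (# 0) | block-incN (# 1)
      ...   | inj₁ (e₀ , _) | _ = ⊥-elim (block-tip-apart (# 0) (trans e₀ (sym e)))
      ...   | inj₂ _ | inj₁ (e₁ , _) = ⊥-elim (block-tip-apart (# 1) (trans e₁ (sym e)))
      ...   | inj₂ (e₀ , e₀') | inj₂ (e₁ , e₁') =
                ⊥-elim (offsets-distinct c (cong coord (α-injective (pair-≡ (trans e₀ (sym e₁)) (trans e₀' (sym e₁'))))))

      block-image : ∀ j → fibre (α f (blockPoint j)) ≡ fibre (β f b) × InBlock (coord (α f (blockPoint j))) (coord (β f b))
      block-image j with block-incN j
      ... | inj₁ h = h
      ... | inj₂ (e , _) = ⊥-elim (block-tip-apart j (trans e (sym (cong fibre tip-image))))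

    σ : Fin k → Fin k
    σ a = fibre (α f (a , # 0))

    g : Fin k → Z7 → Z7
    g a y = coord (α f (a , y))

    σ-fibre : ∀ a y → fibre (α f (a , y)) ≡ σ a
    σ-fibre a y = α-sameFibre (a , y) (a , # 0) refl

    -- α commutes with taking tips, so σ commutes with the successor and g a
    -- maps blocks into blocks of g (a+1)
    σ-next : ∀ a → σ (next a) ≡ next (σ a)
    σ-next a = trans (cong fibre (OnLine.tip-image a (# 0))) (cong next (sym (proj₁ (OnLine.block-image a (# 0) (# 0)))))

    g-blocks : ∀ a → PreservesBlocks (g a) (g (next a))
    g-blocks a .(c +7 offset j) c (j , refl) =
      subst (InBlock (g a (c +7 offset j))) (sym (cong coord (OnLine.tip-image a c))) (proj₂ (OnLine.block-image a c j))

    g-injective : ∀ a {y y'} → g a y ≡ g a y' → y ≡ y'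
    g-injective a {y} {y'} e = cong coord (α-injective (pair-≡ (trans (σ-fibre a y) (sym (σ-fibre a y'))) e))

    -- each g a sits between g (a-1) and g (a+1), so it is affine
    g-affine : ∀ a → ∃ λ i → ∀ y → g a y ≡ affine i (g a (# 0)) y
    g-affine a with next-surjective a
    ... | p , refl = fano-rigidity (g p) (g (next p)) (g (next (next p))) (g-injective (next p)) (g-blocks p) (g-blocks (next p))

    consecutive : ∀ a i t → (∀ y → g a y ≡ affine i t y) → ∀ i' t' → (∀ y → g (next a) y ≡ affine i' t' y) →
                  i ≡ i' × t' ≡ t +7 drift i
    consecutive a i t ga i' t' ga' = affine-consecutive i t i' t' (λ y c r → subst₂ InBlock (ga y) (ga' c) (g-blocks a y c r))

    i₀ : Fin 3
    i₀ = proj₁ (g-affine (0̂ k))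

    t₀ : Z7
    t₀ = g (0̂ k) (# 0)

    s₀ : Fin k
    s₀ = σ (0̂ k)

    -- going around the cycle, fibre m is mapped by the affine map with
    -- translation shift i₀ t₀ m to fibre m + s₀
    Invariant : ℕ → Set
    Invariant m = (∀ y → g (ofℕ k m) y ≡ affine i₀ (shift i₀ t₀ (ofℕ 7 m)) y) × σ (ofℕ k m) ≡ addC k (ofℕ k m) s₀

    next-ofℕ : ∀ m → next (ofℕ k m) ≡ ofℕ k (suc m)
    next-ofℕ m = trans (next-def (ofℕ k m)) (ofℕ-suc k m)

    g-next : ∀ m → Invariant m → ∀ y → g (next (ofℕ k m)) y ≡ affine i₀ (shift i₀ t₀ (ofℕ 7 (suc m))) y
    g-next m (gm , _) y with g-affine (next (ofℕ k m))
    ... | i₁ , g₁ with consecutive (ofℕ k m) i₀ _ gm i₁ _ g₁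
    ... | refl , et = trans (g₁ y) (cong (λ t → affine i₀ t y)
            (trans et (trans (shift-suc i₀ t₀ (ofℕ 7 m)) (cong (shift i₀ t₀) (ofℕ-suc 7 m)))))

    -- the invariant holds for every m, not only m < k
    invariant : ∀ m → Invariant m
    invariant zero = (λ y → trans (proj₂ (g-affine (0̂ k)) y) (cong (λ t → affine i₀ t y) (sym (shift-zero i₀ t₀))))
                   , sym (add-zeroˡ k s₀)
    invariant (suc m) =
        (λ y → subst (λ a → g a y ≡ affine i₀ (shift i₀ t₀ (ofℕ 7 (suc m))) y) (next-ofℕ m) (g-next m (invariant m) y))
      , subst (λ a → σ a ≡ addC k a s₀) (next-ofℕ m)
          (trans (σ-next (ofℕ k m)) (trans (cong next (proj₂ (invariant m))) (next-add (ofℕ k m) s₀)))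

    -- after k steps we are back at fibre 0: the drift must vanish mod 7
    admissible : Admissible i₀
    admissible with shift-periodic i₀ t₀ (ofℕ 7 k) (begin
        t₀                                            ≡⟨ sym (affine-at-0 i₀ t₀) ⟩
        affine i₀ t₀ (# 0)                            ≡⟨ sym (proj₂ (g-affine (0̂ k)) (# 0)) ⟩
        g (0̂ k) (# 0)                                 ≡⟨ cong (λ a → g a (# 0)) (ofℕ-self k) ⟨
        g (ofℕ k k) (# 0)                             ≡⟨ proj₁ (invariant k) (# 0) ⟩
        affine i₀ (shift i₀ t₀ (ofℕ 7 k)) (# 0)       ≡⟨ affine-at-0 i₀ _ ⟩
        shift i₀ t₀ (ofℕ 7 k)                         ∎)
      where open ≡-Reasoning
    ... | inj₁ e = inj₁ e
    ... | inj₂ e = inj₂ (m%n≡0⇒n∣m k 7 (trans (sym (toℕ-ofℕ 7 k)) (cong toℕ e)))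

    acts : Acts f i₀ s₀ t₀
    acts (a , y) with invariant (toℕ a)
    ... | ga , σa = pair-≡ (trans (σ-fibre a y) (subst (λ u → σ u ≡ addC k u s₀) (ofℕ-toℕ k a) σa))
                           (subst (λ u → g u y ≡ affine i₀ (shift i₀ t₀ (π a)) y) (ofℕ-toℕ k a) (ga y))

  classification : (f : Aut k) → Σ (Fin 3 × Fin k × Z7) λ (i , s , t) → Admissible i × Acts f i s t
  classification f = (i₀ f , s₀ f , t₀ f) , admissible f , acts f

module Isomorphism (k : ℕ) .{{_ : NonZero k}} (3≤k : 3 ≤ k) where

  -- The parameters (i, s, t) of an automorphism can be read off from the
  -- images of (0,0) and (0,1); composition of automorphisms corresponds to
  -- the composition law of affineMap.  Any encoding of the admissible
  -- parameters into a group H that is bijective and turns this law into the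
  -- multiplication of H yields Aut ≅ H.

  open Incidence k 3≤k
  open AffineFamily k 3≤k
  open Classification k 3≤k
  open ModArith
  open C7Facts
  open import Data.Fin using (Fin; #_)
  open import Data.Product using (Σ; _×_; _,_)
  open import Function.Bundles using (mk⇔; Equivalence)
  open import Relation.Binary.PropositionalEquality using (_≡_; refl; sym; trans; cong; cong₂; subst; module ≡-Reasoning)
  open Equivalence

  Params : Set
  Params = Fin 3 × Fin k × Z7

  decode : G k → G k → Params
  decode u v = exponentOf (sub 7 (coord v) (coord u)) , fibre u , coord u

  params : Aut k → Params
  params f = decode (α f (0̂ k , # 0)) (α f (0̂ k , # 1))

  params-acts : ∀ f i s t → Acts f i s t → params f ≡ (i , s , t)
  params-acts f i s t acts = begin
      params f
    ≡⟨ cong₂ decode (acts _) (acts _) ⟩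
      exponentOf (sub 7 (affine i T (# 1)) (affine i T (# 0))) , addC k (0̂ k) s , affine i T (# 0)
    ≡⟨ cong (λ w → exponentOf (sub 7 (affine i T (# 1)) w) , addC k (0̂ k) s , w) (affine-at-0 i T) ⟩
      exponentOf (sub 7 (affine i T (# 1)) T) , addC k (0̂ k) s , T
    ≡⟨ cong₂ (λ j u → j , u , T) (exponentOf-affine i T) (add-zeroˡ k s) ⟩
      i , s , T
    ≡⟨ cong (λ w → i , s , w) (trans (cong (shift i t) π-zero) (shift-zero i t)) ⟩
      i , s , t
    ∎
    where
    open ≡-Reasoning
    T : Z7
    T = shift i t (π (0̂ k))

  α-determines : ∀ f g → (∀ x → α f x ≡ α g x) → _≈A_ k f g
  α-determines f g h = h , λ b x → mk⇔ (transfer f g h b x) (transfer g f (λ y → sym (h y)) b x)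
    where
    transfer : ∀ f g → (∀ x → α f x ≡ α g x) → ∀ b x → Inc k x (β f b) → Inc k x (β g b)
    transfer f g h b x i = subst (λ v → Inc k v (β g b)) (trans (sym (h _)) (αα⁻ f x))
      (to (incid g (α⁻ f x) b) (from (incid f (α⁻ f x) b) (subst (λ v → Inc k v (β f b)) (sym (αα⁻ f x)) i)))

  acts-∘ : ∀ f g i s t j s' t' → Admissible i → Acts f i s t → Acts g j s' t' →
           Acts (_∘A_ k f g) (addC 3 i j) (addC k s' s) (shift i (t +7 pow2 i *7 t') (π s'))
  acts-∘ f g i s t j s' t' ok hf hg x = trans (cong (α f) (hg x)) (trans (hf _) (affineMap-∘ i j s t s' t' ok x))

  module FromEncoding (H : Set) (_·_ : H → H → H) (encode : Params → H)
    (encode-injective : ∀ i s t i' s' t' → Admissible i → Admissible i' →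
                        encode (i , s , t) ≡ encode (i' , s' , t') → (i , s , t) ≡ (i' , s' , t'))
    (encode-∘ : ∀ i s t j s' t' → Admissible i → Admissible j →
                encode (addC 3 i j , addC k s' s , shift i (t +7 pow2 i *7 t') (π s')) ≡ encode (i , s , t) · encode (j , s' , t'))
    (encode-surjective : ∀ h → Σ Params λ (i , s , t) → Admissible i × encode (i , s , t) ≡ h)
    where

    φ : Aut k → H
    φ f = encode (params f)

    φ-acts : ∀ f i s t → Acts f i s t → φ f ≡ encode (i , s , t)
    φ-acts f i s t acts = cong encode (params-acts f i s t acts)

    φ-cong : ∀ f g → _≈A_ k f g → φ f ≡ φ g
    φ-cong f g (e , _) = cong₂ (λ u v → encode (decode u v)) (e _) (e _)

    φ-hom : ∀ f g → φ (_∘A_ k f g) ≡ φ f · φ g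
    φ-hom f g with classification f | classification g
    ... | (i , s , t) , ok , hf | (j , s' , t') , ok' , hg = begin
        φ (_∘A_ k f g)
      ≡⟨ φ-acts (_∘A_ k f g) _ _ _ (acts-∘ f g i s t j s' t' ok hf hg) ⟩
        encode (addC 3 i j , addC k s' s , shift i (t +7 pow2 i *7 t') (π s'))
      ≡⟨ encode-∘ i s t j s' t' ok ok' ⟩
        encode (i , s , t) · encode (j , s' , t')
      ≡⟨ cong₂ _·_ (φ-acts f i s t hf) (φ-acts g j s' t' hg) ⟨
        φ f · φ g
      ∎
      where open ≡-Reasoning

    φ-injective : ∀ f g → φ f ≡ φ g → _≈A_ k f g
    φ-injective f g e with classification f | classification g
    ... | (i , s , t) , ok , hf | (i' , s' , t') , ok' , hg
        with encode-injective i s t i' s' t' ok ok' (trans (sym (φ-acts f i s t hf)) (trans e (φ-acts g i' s' t' hg)))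
    ... | refl = α-determines f g (λ x → trans (hf x) (sym (hg x)))

    φ-surjective : ∀ h → Σ (Aut k) λ f → φ f ≡ h
    φ-surjective h with encode-surjective h
    ... | (i , s , t) , ok , e = Automorphism.aut i s t ok , trans (φ-acts (Automorphism.aut i s t ok) i s t (λ x → refl)) e

    autIso : AutIso k H _·_
    autIso = φ , φ-cong , φ-hom , φ-injective , φ-surjective

module Cases (k : ℕ) .{{_ : NonZero k}} (3≤k : 3 ≤ k) where

  open AffineFamily k 3≤k
  open Isomorphism k 3≤k
  open ModArith
  open C7Facts
  open import Data.Nat.Divisibility using (_∣_)
  open import Data.Fin using (zero)
  open import Data.Product using (_,_; proj₁; proj₂)
  open import Data.Sum using (inj₁; inj₂)
  open import Data.Empty using (⊥-elim)
  open import Relation.Nullary using (¬_)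
  open import Relation.Binary.PropositionalEquality using (_≡_; refl; sym; trans; cong; cong₂)

  -- (i) If 7 ∤ k only the exponent 0 is admissible: the automorphisms are
  -- the translations by (s, t).
  module Translations (7∤k : ¬ 7 ∣ k) where

    exponent-zero : ∀ {i} → Admissible i → i ≡ zero
    exponent-zero (inj₁ i≡0) = i≡0
    exponent-zero (inj₂ 7∣k) = ⊥-elim (7∤k 7∣k)

    encode : Params → G k
    encode (_ , s , t) = s , t

    encode-injective : ∀ i s t i' s' t' → Admissible i → Admissible i' →
                       encode (i , s , t) ≡ encode (i' , s' , t') → (i , s , t) ≡ (i' , s' , t')
    encode-injective i s t i' s' t' ok ok' refl = cong (λ j → j , s , t) (trans (exponent-zero ok) (sym (exponent-zero ok')))

    encode-∘ : ∀ i s t j s' t' → Admissible i → Admissible j →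
               encode (addC 3 i j , addC k s' s , shift i (t +7 pow2 i *7 t') (π s')) ≡ _⊕_ k (encode (i , s , t)) (encode (j , s' , t'))
    encode-∘ i s t j s' t' ok ok' with exponent-zero ok | exponent-zero ok'
    ... | refl | refl = cong₂ _,_ (add-comm k s' s) (shift-trivial t t' (π s'))

    autIso : AutIso k (G k) (_⊕_ k)
    autIso = FromEncoding.autIso (G k) (_⊕_ k) encode encode-injective encode-∘
      (λ (s , t) → (zero , s , t) , inj₁ refl , refl)

  -- (ii) If 7 ∣ k all exponents are admissible; normalising the translation
  -- by π s turns the composition law into that of C_3 ⋉ (C_k ⊕ C_7).
  module Semidirect (7∣k : 7 ∣ k) where

    encode : Params → SD k
    encode (i , s , t) = i , s , sub 7 t (π s)

    encode-injective : ∀ i s t i' s' t' → Admissible i → Admissible i' →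
                       encode (i , s , t) ≡ encode (i' , s' , t') → (i , s , t) ≡ (i' , s' , t')
    encode-injective i s t i' s' t' _ _ e with cong proj₁ e | cong (λ h → proj₁ (proj₂ h)) e
    ... | refl | refl = cong (λ u → i , s , u) (sub-injective 7 t t' (π s) (cong (λ h → proj₂ (proj₂ h)) e))

    encode-∘ : ∀ i s t j s' t' → Admissible i → Admissible j →
               encode (addC 3 i j , addC k s' s , shift i (t +7 pow2 i *7 t') (π s')) ≡ _·SD_ k (encode (i , s , t)) (encode (j , s' , t'))
    encode-∘ i s t j s' t' _ _ = cong₂ (λ u v → addC 3 i j , u , v) (add-comm k s' s)
      (trans (cong (sub 7 (shift i (t +7 pow2 i *7 t') (π s'))) (trans (reduce-add k 7 7∣k s' s) (add-comm 7 (π s') (π s))))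
             (shift-semidirect i t t' (π s) (π s')))

    autIso : AutIso k (SD k) (_·SD_ k)
    autIso = FromEncoding.autIso (SD k) (_·SD_ k) encode encode-injective encode-∘
      (λ (i , s , u) → (i , s , u +7 π s) , inj₂ 7∣k , cong (λ v → i , s , v) (sub-add 7 u (π s)))

proposition5p4 : (k : ℕ) .{{_ : NonZero k}} → 3 ≤ k →
    (¬ (7 ∣ k) → AutIso k (G k) (_⊕_ k)) ×
    (7 ∣ k → AutIso k (SD k) (_·SD_ k))
proposition5p4 k 3≤k = (λ 7∤k → Translations.autIso 7∤k) , (λ 7∣k → Semidirect.autIso 7∣k)
  where open Cases k 3≤k
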